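{- For every pattern $p$ over $U$, the family $R_p$ has size at most $2^{|\mathrm{inc}(p)|}$, it represents $p$, and it consists of complete patterns only.
   Context: Let $U$ be a finite totally ordered set and $0\notin U$. A pattern over $U$ is a set $p$ of subsets of $U\cup\{0\}$ such that exactly one member of $p$ contains $0$. Let $\mathrm{lbs}(p)=\bigcup_{S\in p}S\setminus\{0\}$, $\mathrm{sing}(p)=\{u\in U:\{u\}\in p\}$, $\mathrm{inc}(p)=\mathrm{lbs}(p)\setminus\mathrm{sing}(p)$; $p$ is complete if $\mathrm{lbs}(p)=\mathrm{sing}(p)$. If $i\in\mathrm{inc}(p)$, $\mathrm{fix}(p,i)=p\cup\{\{i\}\}$ and $\mathrm{forget}(p,i)=\{S\setminus\{i\}:S\in p\}$; otherwise both equal $p$; these are applied elementwise to families. Let $i_1<\dots<i_\ell$ be the elements of $\mathrm{inc}(p)$, $R_0=\{p\}$, $R_m=\mathrm{forget}(R_{m-1},i_m)\cup\mathrm{fix}(R_{m-1},i_m)$ for $m\in[\ell]$, and $R_p=R_\ell$. For patterns $p,q$, the join $p\sqcup q$ is obtained by relating $S\in p$ and $T\in q$ whenever $S\cap T\neq\emptyset$, taking the equivalence closure on the members of $p$ and $q$, and forming the union of the members of each class; $p\sim q$ if $p\sqcup q$ consists of a single set. A family $R$ represents $p$ if for every pattern $q$: $p\sim q$ if and only if there is $p'\in R$ with $p'\sim q$. -}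

module Defs where

open import Data.Nat using (ℕ; suc; _≤_; _^_)
open import Data.Bool using (Bool)
import Data.Bool as Bool
open import Data.Fin using (Fin; zero; suc)
open import Data.Fin.Subset using (Subset; _∈_; _∉_; ⁅_⁆; _∩_; _-_; Nonempty)
open import Data.Fin.Subset.Properties using (_∈?_)
open import Data.Vec.Properties using (≡-dec)
open import Data.List using (List; []; _∷_; _++_; map; filter; foldl; length; deduplicate; allFin)
import Data.List.Membership.Propositional as LMem
import Data.List.Membership.DecPropositional as DecMem
open import Data.List.Relation.Unary.All using (All; all?)
open import Data.List.Relation.Unary.Any using (any?)
open import Data.Product using (Σ; ∃; ∃-syntax; _×_; _,_; proj₁)
open import Data.Sum using (_⊎_; inj₁; inj₂)
open import Relation.Nullary using (¬_; Dec; yes; no; ¬?; _×-dec_)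
open import Relation.Binary.PropositionalEquality using (_≡_; refl)
open import Data.List.Relation.Unary.Any using (here; there)
open import Relation.Binary.Construct.Closure.Equivalence using (EqClosure)
open import Function using (_⇔_)

-- U = Fin n (with its natural total order); U ∪ {0} is encoded as Fin (suc n):
-- the new element 0 is `zero`, and u ∈ U is `suc u`.
Elem : ℕ → Set
Elem n = Fin (suc n)

Sub : ℕ → Set
Sub n = Subset (suc n)

_≟S_ : ∀ {n} (S T : Sub n) → Dec (S ≡ T)
_≟S_ = ≡-dec Bool._≟_

-- A (candidate) pattern: a finite set of subsets of U ∪ {0}, given by a list
-- read with set semantics (membership only; order/duplicates irrelevant).
Pat : ℕ → Set
Pat n = List (Sub n)

_∈ₚ_ : ∀ {n} → Sub n → Pat n → Set
S ∈ₚ p = LMem._∈_ S p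

IsPattern : ∀ {n} → Pat n → Set
IsPattern {n} p =
  (∃[ S ] (S ∈ₚ p × zero ∈ S)) ×
  (∀ S T → S ∈ₚ p → T ∈ₚ p → zero ∈ S → zero ∈ T → S ≡ T)

InLbs : ∀ {n} → Pat n → Fin n → Set
InLbs p u = ∃[ S ] (S ∈ₚ p × suc u ∈ S)

InSing : ∀ {n} → Pat n → Fin n → Set
InSing p u = ⁅ suc u ⁆ ∈ₚ p

InInc : ∀ {n} → Pat n → Fin n → Set
InInc p u = InLbs p u × ¬ InSing p u

Complete : ∀ {n} → Pat n → Set
Complete p = ∀ u → InLbs p u ⇔ InSing p u

inLbs? : ∀ {n} (p : Pat n) (u : Fin n) → Dec (InLbs p u)
inLbs? [] u = no (λ { (S , () , _) })
inLbs? (S ∷ p) u with suc u ∈? S | inLbs? p u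
... | yes s | _ = yes (S , here refl , s)
... | no _ | yes (T , T∈ , t) = yes (T , there T∈ , t)
... | no ¬s | no ¬r = no lemma
  where
  lemma : ¬ InLbs (S ∷ p) u
  lemma (.S , here refl , s) = ¬s s
  lemma (T , there T∈ , t) = ¬r (T , T∈ , t)

inSing? : ∀ {n} (p : Pat n) (u : Fin n) → Dec (InSing p u)
inSing? p u = DecMem._∈?_ _≟S_ ⁅ suc u ⁆ p

inInc? : ∀ {n} (p : Pat n) (u : Fin n) → Dec (InInc p u)
inInc? p u = inLbs? p u ×-dec ¬? (inSing? p u)

-- inc(p) listed in increasing order i₁ < … < i_ℓ
incList : ∀ {n} → Pat n → List (Fin n)
incList {n} p = filter (inInc? p) (allFin n)

fix : ∀ {n} → Pat n → Fin n → Pat n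
fix p i with inInc? p i
... | yes _ = ⁅ suc i ⁆ ∷ p
... | no _ = p

forget : ∀ {n} → Pat n → Fin n → Pat n
forget p i with inInc? p i
... | yes _ = map (λ S → S - suc i) p
... | no _ = p

-- families of patterns (lists read as finite sets)
Fam : ℕ → Set
Fam n = List (Pat n)

step : ∀ {n} → Fam n → Fin n → Fam n
step R i = map (λ q → forget q i) R ++ map (λ q → fix q i) R

Rfam : ∀ {n} → Pat n → Fam n
Rfam p = foldl step (p ∷ []) (incList p)

_≋_ : ∀ {n} → Pat n → Pat n → Set
p ≋ q = All (_∈ₚ q) p × All (_∈ₚ p) q

_≋?_ : ∀ {n} (p q : Pat n) → Dec (p ≋ q)
p ≋? q = all? (λ S → DecMem._∈?_ _≟S_ S q) p ×-dec all? (λ S → DecMem._∈?_ _≟S_ S p) q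

card : ∀ {n} → Fam n → ℕ
card R = length (deduplicate _≋?_ R)

-- Join.  Nodes are the members of p (inj₁) and of q (inj₂).
Node : ∀ {n} → Pat n → Pat n → Set
Node {n} p q = Σ (Sub n) (λ S → S ∈ₚ p ⊎ S ∈ₚ q)

data Meets {n} (p q : Pat n) : Node p q → Node p q → Set where
  meets : ∀ {S T} (S∈ : S ∈ₚ p) (T∈ : T ∈ₚ q) → Nonempty (S ∩ T) →
          Meets p q (S , inj₁ S∈) (T , inj₂ T∈)

InClassUnion : ∀ {n} (p q : Pat n) → Node p q → Elem n → Set
InClassUnion p q X x = ∃[ Y ] (EqClosure (Meets p q) X Y × x ∈ proj₁ Y)

-- p ⊔ q consists of a single set W
_∼_ : ∀ {n} → Pat n → Pat n → Set
_∼_ {n} p q =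
  ∃[ W ] ((Σ (Node p q) λ X → ∀ x → InClassUnion p q X x ⇔ x ∈ W) ×
          (∀ (X : Node p q) x → InClassUnion p q X x ⇔ x ∈ W))

Represents : ∀ {n} → Fam n → Pat n → Set
Represents R p = ∀ q → IsPattern q → (p ∼ q ⇔ (∃[ p' ] (p' LMem.∈ R × p' ∼ q)))

{-# OPTIONS --safe #-}
-- The blocks of p and q form a bipartite meet graph, and when both patterns have a block
-- containing 0, p ∼ q holds exactly when this graph is connected (the two 0-blocks glue every
-- class containing 0 together).  Let i ∈ inc(p), with i in the block S of p.  The new block {i}
-- meets only blocks that S meets, and deleting i from every block only removes edges, so if
-- fix(p,i) or forget(p,i) is connected with q then so is p.  Conversely, if i lies in a block T
-- of q then {i} hangs off T and fix(p,i) stays connected; otherwise no edge uses i and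
-- forget(p,i) stays connected.  Each step doubles the family, keeps its members patterns and
-- removes i from their inc, so after all of inc(p) has been processed every member is complete.
module Submission where

open import Defs
open import Data.Nat using (ℕ; _≤_; _^_; _+_; _*_)
open import Data.Nat.Properties
  using (*-comm; *-assoc; *-identityʳ; +-identityʳ; ≤-trans; ≤-reflexive)
open import Data.Fin using (Fin; zero; suc)
import Data.Fin.Properties as Fin
open import Data.Fin.Subset using (Subset; ⁅_⁆; _∩_; _-_; _─_; _⊆_; ⋃; outside; Nonempty)
  renaming (_∈_ to _∈ˢ_; _∉_ to _∉ˢ_)
open import Data.Fin.Subset.Properties
  using (x∈p∩q⁺; x∈p∩q⁻; x∈p∪q⁺; x∈p∪q⁻; ∉⊥; ⊆-antisym; x∈⁅x⁆; x∈⁅y⁆⇒x≡y;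
         p─q⊆p; x∈p∧x≢y⇒x∈p-y)
open import Data.Vec using (_∷_; here; there)
open import Data.List using (List; []; _∷_; _++_; map; foldl; length)
open import Data.List.Properties using (length-++; length-map; length-deduplicate)
open import Data.List.Membership.Propositional using (_∈_; find; lose)
open import Data.List.Membership.Propositional.Properties
  using (∈-++⁺ˡ; ∈-++⁺ʳ; ∈-++⁻; map-∈↔; ∈-map⁺; ∈-map⁻; ∈-filter⁺; ∈-allFin)
open import Data.List.Relation.Unary.Any as Any using (Any; here; there)
open import Data.List.Relation.Unary.Any.Properties
  using (map⁺; map⁻; ++⁺ˡ; ++⁺ʳ; ++⁻; Any-⊎⁻; singleton⁻)
open import Data.List.Relation.Unary.All as All using (All; []; _∷_)
import Data.List.Relation.Unary.All.Properties as All
open import Data.Product using (∃; ∃-syntax; _×_; _,_; proj₁; proj₂)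
open import Data.Sum using (_⊎_; inj₁; inj₂; reduce)
open import Data.Empty using (⊥-elim)
open import Function using (_⇔_; mk⇔; _∘_; id; case_of_; Equivalence; Inverse)
open import Function.Construct.Composition using (_⇔-∘_)
open import Function.Construct.Identity using (⇔-id)
open import Function.Related.Propositional using (module EquationalReasoning)
open import Relation.Nullary using (¬_; yes; no)
open import Relation.Nullary.Decidable using (decidable-stable)
open import Relation.Binary.PropositionalEquality
  using (_≡_; _≢_; refl; sym; trans; cong; cong₂; subst; module ≡-Reasoning)
open import Relation.Binary.Construct.Closure.Equivalence using (EqClosure; gmap; symmetric)
open import Relation.Binary.Construct.Closure.Symmetric using (fwd; bwd)
open import Relation.Binary.Construct.Closure.ReflexiveTransitive using (ε; _◅_; _◅◅_)

private
  variable
    n : ℕ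

x∈p─q⇒x∉q : ∀ {m} {p q : Subset m} {x} → x ∈ˢ p ─ q → x ∉ˢ q
x∈p─q⇒x∉q {p = _ ∷ _} {outside ∷ _} here      ()
x∈p─q⇒x∉q {p = _ ∷ _} {_ ∷ _}       (there x) (there y) = x∈p─q⇒x∉q x y

⁅x⁆-y≡⁅x⁆ : ∀ {m} {x y : Fin m} → x ≢ y → ⁅ x ⁆ - y ≡ ⁅ x ⁆
⁅x⁆-y≡⁅x⁆ {x = x} {y} x≢y = ⊆-antisym (p─q⊆p ⁅ x ⁆ ⁅ y ⁆) ⁅x⁆⊆⁅x⁆-y
  where
  ⁅x⁆⊆⁅x⁆-y : ⁅ x ⁆ ⊆ ⁅ x ⁆ - y
  ⁅x⁆⊆⁅x⁆-y z∈⁅x⁆ with x∈⁅y⁆⇒x≡y x z∈⁅x⁆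
  ... | refl = x∈p∧x≢y⇒x∈p-y (x∈⁅x⁆ x) x≢y

x∈⋃⁺ : ∀ {m} {Ss : List (Subset m)} {S x} → S ∈ Ss → x ∈ˢ S → x ∈ˢ ⋃ Ss
x∈⋃⁺ (here refl) x∈S = x∈p∪q⁺ (inj₁ x∈S)
x∈⋃⁺ (there S∈)  x∈S = x∈p∪q⁺ (inj₂ (x∈⋃⁺ S∈ x∈S))

x∈⋃⁻ : ∀ {m} (Ss : List (Subset m)) {x} → x ∈ˢ ⋃ Ss → ∃[ S ] (S ∈ Ss × x ∈ˢ S)
x∈⋃⁻ []       x∈⋃ = ⊥-elim (∉⊥ x∈⋃)
x∈⋃⁻ (S ∷ Ss) x∈⋃ with x∈p∪q⁻ S (⋃ Ss) x∈⋃
... | inj₁ x∈S = S , here refl , x∈S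
... | inj₂ x∈⋃Ss with x∈⋃⁻ Ss x∈⋃Ss
...   | T , T∈ , x∈T = T , there T∈ , x∈T

Linked : (r q : Pat n) → Node r q → Node r q → Set
Linked r q = EqClosure (Meets r q)

Connected : Pat n → Pat n → Set
Connected r q = ∀ X Y → Linked r q X Y

HasZeroBlock : Pat n → Set
HasZeroBlock p = ∃[ S ] (S ∈ₚ p × zero ∈ˢ S)

≡⇒Linked : {r q : Pat n} {X Y : Node r q} → X ≡ Y → Linked r q X Y
≡⇒Linked refl = ε

Connected-transfer : {r r′ q : Pat n} (g : Node r q → Node r′ q) →
  (∀ {X Y} → Meets r q X Y → Meets r′ q (g X) (g Y)) →
  (∀ Y → ∃[ X ] Linked r′ q Y (g X)) →
  Connected r q → Connected r′ q
Connected-transfer {r′ = r′} {q} g g-meets g-covers conn Y Y′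
  with g-covers Y | g-covers Y′
... | X , Y~gX | X′ , Y′~gX′ =
  Y~gX ◅◅ gmap g g-meets (conn X X′) ◅◅ symmetric (Meets r′ q) Y′~gX′

zero-block-linked : {r q : Pat n} {R₀ T₀ : Sub n} → R₀ ∈ₚ r → zero ∈ˢ R₀ →
  (T₀∈q : T₀ ∈ₚ q) → zero ∈ˢ T₀ → ∀ X → zero ∈ˢ proj₁ X → Linked r q X (T₀ , inj₂ T₀∈q)
zero-block-linked R₀∈r 0∈R₀ T₀∈q 0∈T₀ (S , inj₁ S∈r) 0∈S =
  fwd (meets S∈r T₀∈q (zero , x∈p∩q⁺ (0∈S , 0∈T₀))) ◅ ε
zero-block-linked R₀∈r 0∈R₀ T₀∈q 0∈T₀ (T , inj₂ T∈q) 0∈T =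
  bwd (meets R₀∈r T∈q (zero , x∈p∩q⁺ (0∈R₀ , 0∈T))) ◅
  fwd (meets R₀∈r T₀∈q (zero , x∈p∩q⁺ (0∈R₀ , 0∈T₀))) ◅ ε

∼⇒Connected : {r q : Pat n} → HasZeroBlock r → HasZeroBlock q → r ∼ q → Connected r q
∼⇒Connected {r = r} {q} (R₀ , R₀∈r , 0∈R₀) (T₀ , T₀∈q , 0∈T₀) (W , _ , class≡W) X Y =
  X~T₀ X ◅◅ symmetric (Meets r q) (X~T₀ Y)
  where
  T₀-node : Node r q
  T₀-node = T₀ , inj₂ T₀∈q
  0∈W : zero ∈ˢ W
  0∈W = Equivalence.to (class≡W T₀-node zero) (T₀-node , ε , 0∈T₀)
  X~T₀ : ∀ X → Linked r q X T₀-node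
  X~T₀ X with Equivalence.from (class≡W X zero) 0∈W
  ... | Z , X~Z , 0∈Z = X~Z ◅◅ zero-block-linked R₀∈r 0∈R₀ T₀∈q 0∈T₀ Z 0∈Z

Connected⇒∼ : {r q : Pat n} {T₀ : Sub n} → T₀ ∈ₚ q → Connected r q → r ∼ q
Connected⇒∼ {r = r} {q} {T₀} T₀∈q conn = ⋃ (r ++ q) , (T₀-node , class≡⋃ T₀-node) , class≡⋃
  where
  T₀-node : Node r q
  T₀-node = T₀ , inj₂ T₀∈q
  class≡⋃ : ∀ X x → InClassUnion r q X x ⇔ x ∈ˢ ⋃ (r ++ q)
  class≡⋃ X x = mk⇔ to from
    where
    to : InClassUnion r q X x → x ∈ˢ ⋃ (r ++ q)
    to ((S , inj₁ S∈r) , _ , x∈S) = x∈⋃⁺ (∈-++⁺ˡ S∈r) x∈S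
    to ((T , inj₂ T∈q) , _ , x∈T) = x∈⋃⁺ (∈-++⁺ʳ r T∈q) x∈T
    from : x ∈ˢ ⋃ (r ++ q) → InClassUnion r q X x
    from x∈⋃ with x∈⋃⁻ (r ++ q) x∈⋃
    ... | S , S∈ , x∈S with ∈-++⁻ r S∈
    ...   | inj₁ S∈r = (S , inj₁ S∈r) , conn X _ , x∈S
    ...   | inj₂ S∈q = (S , inj₂ S∈q) , conn X _ , x∈S

∼⇔Connected : {r q : Pat n} → HasZeroBlock r → HasZeroBlock q → r ∼ q ⇔ Connected r q
∼⇔Connected r-zero q-zero@(_ , T₀∈q , _) = mk⇔ (∼⇒Connected r-zero q-zero) (Connected⇒∼ T₀∈q)

Connected-∷⁻ : {r q : Pat n} {B S : Sub n} → B ⊆ S → S ∈ₚ r →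
  Connected (B ∷ r) q → Connected r q
Connected-∷⁻ {r = r} {q} {B} {S} B⊆S S∈r = Connected-transfer g g-meets g-covers
  where
  g : Node (B ∷ r) q → Node r q
  g (_ , inj₁ (here _))     = S , inj₁ S∈r
  g (X , inj₁ (there X∈r))  = X , inj₁ X∈r
  g (T , inj₂ T∈q)          = T , inj₂ T∈q
  g-meets : ∀ {X Y} → Meets (B ∷ r) q X Y → Meets r q (g X) (g Y)
  g-meets (meets (here refl) T∈q (x , x∈B∩T)) with x∈p∩q⁻ _ _ x∈B∩T
  ... | x∈B , x∈T = meets S∈r T∈q (x , x∈p∩q⁺ (B⊆S x∈B , x∈T))
  g-meets (meets (there X∈r) T∈q X∩T≠∅) = meets X∈r T∈q X∩T≠∅
  g-covers : ∀ Y → ∃[ X ] Linked r q Y (g X)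
  g-covers (X , inj₁ X∈r) = (X , inj₁ (there X∈r)) , ε
  g-covers (T , inj₂ T∈q) = (T , inj₂ T∈q) , ε

Connected-∷⁺ : {r q : Pat n} {B T : Sub n} → T ∈ₚ q → Nonempty (B ∩ T) →
  Connected r q → Connected (B ∷ r) q
Connected-∷⁺ {r = r} {q} {B} {T} T∈q B∩T≠∅ = Connected-transfer g g-meets g-covers
  where
  g : Node r q → Node (B ∷ r) q
  g (X , inj₁ X∈r) = X , inj₁ (there X∈r)
  g (X , inj₂ X∈q) = X , inj₂ X∈q
  g-meets : ∀ {X Y} → Meets r q X Y → Meets (B ∷ r) q (g X) (g Y)
  g-meets (meets X∈r Y∈q X∩Y≠∅) = meets (there X∈r) Y∈q X∩Y≠∅
  g-covers : ∀ Y → ∃[ X ] Linked (B ∷ r) q Y (g X)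
  g-covers (_ , inj₁ (here refl)) = (T , inj₂ T∈q) , fwd (meets (here refl) T∈q B∩T≠∅) ◅ ε
  g-covers (X , inj₁ (there X∈r)) = (X , inj₁ X∈r) , ε
  g-covers (X , inj₂ X∈q)         = (X , inj₂ X∈q) , ε

module _ (f : Sub n → Sub n) {r q : Pat n} where

  private
    module M {S′} = Inverse (map-∈↔ f {xs = r} {y = S′})

    preimage : Node (map f r) q → Node r q
    preimage (S′ , inj₁ S′∈) = proj₁ (M.from S′∈) , inj₁ (proj₁ (proj₂ (M.from S′∈)))
    preimage (T , inj₂ T∈q)  = T , inj₂ T∈q

    image : Node r q → Node (map f r) q
    image (S , inj₁ S∈r) = f S , inj₁ (M.to (S , S∈r , refl))
    image (T , inj₂ T∈q) = T , inj₂ T∈q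

    preimage-image : ∀ X → preimage (image X) ≡ X
    preimage-image (S , inj₁ S∈r) =
      cong (λ (S , S∈r , _) → S , inj₁ S∈r) (M.strictlyInverseʳ (S , S∈r , refl))
    preimage-image (T , inj₂ T∈q) = refl

    image-preimage : ∀ Y → image (preimage Y) ≡ Y
    image-preimage (S′ , inj₁ S′∈) with M.from S′∈ | M.strictlyInverseˡ S′∈
    ... | S , S∈r , refl | refl = refl
    image-preimage (T , inj₂ T∈q) = refl

  Connected-map⁻ : (∀ S → f S ⊆ S) → Connected (map f r) q → Connected r q
  Connected-map⁻ shrinks =
    Connected-transfer preimage g-meets λ Y → image Y , ≡⇒Linked (sym (preimage-image Y))
    where
    g-meets : ∀ {X Y} → Meets (map f r) q X Y → Meets r q (preimage X) (preimage Y)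
    g-meets (meets S′∈ T∈q (x , x∈S′∩T)) with M.from S′∈ | x∈p∩q⁻ _ _ x∈S′∩T
    ... | S , S∈r , refl | x∈fS , x∈T = meets S∈r T∈q (x , x∈p∩q⁺ (shrinks S x∈fS , x∈T))

  Connected-map⁺ : (∀ {S T} → T ∈ₚ q → Nonempty (S ∩ T) → Nonempty (f S ∩ T)) →
    Connected r q → Connected (map f r) q
  Connected-map⁺ keeps-meets =
    Connected-transfer image g-meets λ Y → preimage Y , ≡⇒Linked (sym (image-preimage Y))
    where
    g-meets : ∀ {X Y} → Meets r q X Y → Meets (map f r) q (image X) (image Y)
    g-meets (meets S∈r T∈q S∩T≠∅) = meets (M.to (_ , S∈r , refl)) T∈q (keeps-meets T∈q S∩T≠∅)

Connected-step : (q r : Pat n) (i : Fin n) →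
  Connected r q ⇔ (Connected (forget r i) q ⊎ Connected (fix r i) q)
Connected-step q r i with inInc? r i
... | no _ = mk⇔ inj₁ reduce
... | yes ((S , S∈r , i∈S) , _) = mk⇔ to from
  where
  to : Connected r q → Connected (map (_- suc i) r) q ⊎ Connected (⁅ suc i ⁆ ∷ r) q
  to conn with inLbs? q i
  ... | yes (T , T∈q , i∈T) =
    inj₂ (Connected-∷⁺ {B = ⁅ suc i ⁆} T∈q (suc i , x∈p∩q⁺ (x∈⁅x⁆ (suc i) , i∈T)) conn)
  ... | no i∉q = inj₁ (Connected-map⁺ (_- suc i) keeps-meets conn)
    where
    keeps-meets : ∀ {S T} → T ∈ₚ q → Nonempty (S ∩ T) → Nonempty ((S - suc i) ∩ T)
    keeps-meets {T = T} T∈q (x , x∈S∩T) with x∈p∩q⁻ _ _ x∈S∩T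
    ... | x∈S , x∈T =
      x , x∈p∩q⁺ (x∈p∧x≢y⇒x∈p-y {y = suc i} x∈S (λ { refl → i∉q (T , T∈q , x∈T) }) , x∈T)
  from : Connected (map (_- suc i) r) q ⊎ Connected (⁅ suc i ⁆ ∷ r) q → Connected r q
  from (inj₁ conn) = Connected-map⁻ (_- suc i) (λ S → p─q⊆p S ⁅ suc i ⁆) conn
  from (inj₂ conn) = Connected-∷⁻ ⁅i⁆⊆S S∈r conn
    where
    ⁅i⁆⊆S : ⁅ suc i ⁆ ⊆ S
    ⁅i⁆⊆S y∈⁅i⁆ = subst (_∈ˢ S) (sym (x∈⁅y⁆⇒x≡y (suc i) y∈⁅i⁆)) i∈S

module _ {P : Pat n → Set} (split : ∀ r i → P r ⇔ (P (forget r i) ⊎ P (fix r i))) where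

  Any-step : ∀ R i → Any P R ⇔ Any P (step R i)
  Any-step R i = mk⇔ to from
    where
    forget-i fix-i : Pat n → Pat n
    forget-i r = forget r i
    fix-i r = fix r i
    split-from : ∀ {r} → P (forget r i) ⊎ P (fix r i) → P r
    split-from = Equivalence.from (split _ i)
    to : Any P R → Any P (step R i)
    to any with Any-⊎⁻ (Any.map (Equivalence.to (split _ i)) any)
    ... | inj₁ any-forget = ++⁺ˡ (map⁺ {f = forget-i} any-forget)
    ... | inj₂ any-fix    = ++⁺ʳ (map forget-i R) (map⁺ {f = fix-i} any-fix)
    from : Any P (step R i) → Any P R
    from any with ++⁻ (map forget-i R) any
    ... | inj₁ any-forget = Any.map (split-from ∘ inj₁) (map⁻ {f = forget-i} any-forget)
    ... | inj₂ any-fix    = Any.map (split-from ∘ inj₂) (map⁻ {f = fix-i} any-fix)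

  Any-foldl-step : ∀ R L → Any P R ⇔ Any P (foldl step R L)
  Any-foldl-step R []      = ⇔-id _
  Any-foldl-step R (i ∷ L) = Any-foldl-step (step R i) L ⇔-∘ Any-step R i

module _ {P : List (Fin n) → Pat n → Set}
         (preserved : ∀ {L r} i → P (i ∷ L) r → P L (forget r i) × P L (fix r i)) where

  All-step : ∀ {L} R i → All (P (i ∷ L)) R → All (P L) (step R i)
  All-step R i all = All.++⁺ (All.map⁺ (All.map (proj₁ ∘ preserved i) all))
                             (All.map⁺ (All.map (proj₂ ∘ preserved i) all))

  All-foldl-step : ∀ R L → All (P L) R → All (P []) (foldl step R L)
  All-foldl-step R []      = id
  All-foldl-step R (i ∷ L) = All-foldl-step (step R i) L ∘ All-step R i

IsPattern-∷ : {p : Pat n} {B : Sub n} → zero ∉ˢ B → IsPattern p → IsPattern (B ∷ p)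
IsPattern-∷ {p = p} {B} 0∉B ((S , S∈p , 0∈S) , unique) = (S , there S∈p , 0∈S) , unique′
  where
  unique′ : ∀ S T → S ∈ₚ (B ∷ p) → T ∈ₚ (B ∷ p) → zero ∈ˢ S → zero ∈ˢ T → S ≡ T
  unique′ S T (here refl) _           0∈S _   = ⊥-elim (0∉B 0∈S)
  unique′ S T (there _)   (here refl) _   0∈T = ⊥-elim (0∉B 0∈T)
  unique′ S T (there S∈p) (there T∈p) 0∈S 0∈T = unique S T S∈p T∈p 0∈S 0∈T

IsPattern-map : {p : Pat n} (f : Sub n → Sub n) →
  (∀ {S} → zero ∈ˢ S → zero ∈ˢ f S) → (∀ {S} → zero ∈ˢ f S → zero ∈ˢ S) →
  IsPattern p → IsPattern (map f p)
IsPattern-map {p = p} f keeps-0 reflects-0 ((S , S∈p , 0∈S) , unique) =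
  (f S , ∈-map⁺ f S∈p , keeps-0 0∈S) , unique′
  where
  unique′ : ∀ S′ T′ → S′ ∈ₚ map f p → T′ ∈ₚ map f p → zero ∈ˢ S′ → zero ∈ˢ T′ → S′ ≡ T′
  unique′ S′ T′ S′∈ T′∈ 0∈S′ 0∈T′ with ∈-map⁻ f S′∈ | ∈-map⁻ f T′∈
  ... | S , S∈p , refl | T , T∈p , refl =
    cong f (unique S T S∈p T∈p (reflects-0 0∈S′) (reflects-0 0∈T′))

IsPattern-forget : ∀ {r : Pat n} i → IsPattern r → IsPattern (forget r i)
IsPattern-forget {r = r} i with inInc? r i
... | no _  = id
... | yes _ =
  IsPattern-map (_- suc i) (λ 0∈S → x∈p∧x≢y⇒x∈p-y {y = suc i} 0∈S λ ()) (p─q⊆p _ ⁅ suc i ⁆)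

IsPattern-fix : ∀ {r : Pat n} i → IsPattern r → IsPattern (fix r i)
IsPattern-fix {r = r} i with inInc? r i
... | no _  = id
... | yes _ = IsPattern-∷ (λ 0∈⁅i⁆ → case x∈⁅y⁆⇒x≡y (suc i) 0∈⁅i⁆ of λ ())

InInc-forget : ∀ {r : Pat n} {u} i → InInc (forget r i) u → InInc r u × u ≢ i
InInc-forget {r = r} {u} i inc with inInc? r i
... | no i∉inc = inc , λ { refl → i∉inc inc }
... | yes _ with inc
...   | (S′ , S′∈ , u∈S′) , ¬sing with ∈-map⁻ (_- suc i) S′∈
...     | S , S∈r , refl = ((S , S∈r , p─q⊆p S ⁅ suc i ⁆ u∈S′) , ¬sing′) , u≢i
  where
  u≢i : u ≢ i
  u≢i refl = x∈p─q⇒x∉q u∈S′ (x∈⁅x⁆ (suc i))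
  ¬sing′ : ¬ InSing r u
  ¬sing′ sing = ¬sing (subst (_∈ₚ map (_- suc i) r) ⁅u⁆-i≡⁅u⁆ (∈-map⁺ (_- suc i) sing))
    where
    ⁅u⁆-i≡⁅u⁆ : ⁅ suc u ⁆ - suc i ≡ ⁅ suc u ⁆
    ⁅u⁆-i≡⁅u⁆ = ⁅x⁆-y≡⁅x⁆ (u≢i ∘ Fin.suc-injective)

InInc-fix : ∀ {r : Pat n} {u} i → InInc (fix r i) u → InInc r u × u ≢ i
InInc-fix {r = r} {u} i inc with inInc? r i
... | no i∉inc = inc , λ { refl → i∉inc inc }
... | yes _ = fix-inc inc
  where
  fix-inc : InInc (⁅ suc i ⁆ ∷ r) u → InInc r u × u ≢ i
  fix-inc ((_ , here refl , u∈⁅i⁆) , ¬sing) with Fin.suc-injective (x∈⁅y⁆⇒x≡y (suc i) u∈⁅i⁆)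
  ... | refl = ⊥-elim (¬sing (here refl))
  fix-inc ((S , there S∈r , u∈S) , ¬sing) =
    ((S , S∈r , u∈S) , ¬sing ∘ there) , λ { refl → ¬sing (here refl) }

PatternWithIncIn : List (Fin n) → Pat n → Set
PatternWithIncIn L r = IsPattern r × (∀ u → InInc r u → u ∈ L)

PatternWithIncIn-step : ∀ {L} {r : Pat n} i → PatternWithIncIn (i ∷ L) r →
  PatternWithIncIn L (forget r i) × PatternWithIncIn L (fix r i)
PatternWithIncIn-step {L = L} {r} i (r-pat , inc⊆i∷L) =
  (IsPattern-forget i r-pat , inc⊆L (InInc-forget i)) ,
  (IsPattern-fix i r-pat , inc⊆L (InInc-fix i))
  where
  inc⊆L : ∀ {r′} → (∀ {u} → InInc r′ u → InInc r u × u ≢ i) → ∀ u → InInc r′ u → u ∈ L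
  inc⊆L inc-shrinks u u∈inc with inc-shrinks u∈inc
  ... | u∈inc-r , u≢i with inc⊆i∷L u u∈inc-r
  ...   | here u≡i  = ⊥-elim (u≢i u≡i)
  ...   | there u∈L = u∈L

inc≡∅⇒Complete : {r : Pat n} → (∀ u → InInc r u → u ∈ []) → Complete r
inc≡∅⇒Complete {r = r} inc≡∅ u = mk⇔ lbs⇒sing (λ sing → ⁅ suc u ⁆ , sing , x∈⁅x⁆ (suc u))
  where
  lbs⇒sing : InLbs r u → InSing r u
  lbs⇒sing lbs = decidable-stable (inSing? r u) (λ ¬sing → case inc≡∅ u (lbs , ¬sing) of λ ())

Rfam-patterns : (p : Pat n) → IsPattern p → All (PatternWithIncIn []) (Rfam p)
Rfam-patterns p p-pat =
  All-foldl-step {P = PatternWithIncIn} PatternWithIncIn-step (p ∷ []) (incList p) (p-inc ∷ [])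
  where
  p-inc : PatternWithIncIn (incList p) p
  p-inc = p-pat , λ u u∈inc → ∈-filter⁺ (inInc? p) (∈-allFin u) u∈inc

Any-Connected⇔∃∼ : {R : Fam n} {q : Pat n} → All HasZeroBlock R → HasZeroBlock q →
  Any (λ r → Connected r q) R ⇔ (∃[ r ] (r ∈ R × r ∼ q))
Any-Connected⇔∃∼ R-zero q-zero = mk⇔
  (λ any → let (r , r∈R , conn) = find any in
           r , r∈R , Equivalence.from (∼⇔Connected (All.lookup R-zero r∈R) q-zero) conn)
  (λ (r , r∈R , r∼q) → lose r∈R (Equivalence.to (∼⇔Connected (All.lookup R-zero r∈R) q-zero) r∼q))

Rfam-represents : (p : Pat n) → IsPattern p → Represents (Rfam p) p
Rfam-represents p p-pat q (q-zero , _) = begin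
  p ∼ q                                ∼⟨ ∼⇔Connected (proj₁ p-pat) q-zero ⟩
  Connected p q                        ∼⟨ mk⇔ here singleton⁻ ⟩
  Any (λ r → Connected r q) (p ∷ [])   ∼⟨ Any-foldl-step (Connected-step q) (p ∷ []) (incList p) ⟩
  Any (λ r → Connected r q) (Rfam p)   ∼⟨ Any-Connected⇔∃∼ R-zero q-zero ⟩
  (∃[ r ] (r ∈ Rfam p × r ∼ q))        ∎
  where
  open EquationalReasoning
  R-zero : All HasZeroBlock (Rfam p)
  R-zero = All.map (proj₁ ∘ proj₁) (Rfam-patterns p p-pat)

length-step : (R : Fam n) (i : Fin n) → length (step R i) ≡ 2 * length R
length-step R i = begin
  length (step R i)                    ≡⟨ length-++ (map (λ r → forget r i) R) ⟩
  length (map _ R) + length (map _ R)  ≡⟨ cong₂ _+_ (length-map _ R) (length-map _ R) ⟩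
  length R + length R                  ≡⟨ cong (length R +_) (+-identityʳ (length R)) ⟨
  2 * length R                         ∎
  where open ≡-Reasoning

length-foldl-step : (R : Fam n) (L : List (Fin n)) →
  length (foldl step R L) ≡ length R * 2 ^ length L
length-foldl-step R []      = sym (*-identityʳ (length R))
length-foldl-step R (i ∷ L) = begin
  length (foldl step (step R i) L)   ≡⟨ length-foldl-step (step R i) L ⟩
  length (step R i) * 2 ^ length L   ≡⟨ cong (_* 2 ^ length L) (length-step R i) ⟩
  2 * length R * 2 ^ length L        ≡⟨ cong (_* 2 ^ length L) (*-comm 2 (length R)) ⟩
  length R * 2 * 2 ^ length L        ≡⟨ *-assoc (length R) 2 (2 ^ length L) ⟩
  length R * (2 * 2 ^ length L)      ∎
  where open ≡-Reasoning

card-Rfam : (p : Pat n) → card (Rfam p) ≤ 2 ^ length (incList p)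
card-Rfam p = ≤-trans (length-deduplicate _≋?_ (Rfam p))
                      (≤-reflexive (trans (length-foldl-step (p ∷ []) (incList p)) (+-identityʳ _)))

lemma6p11 : ∀ {n} (p : Pat n) → IsPattern p →
    card (Rfam p) ≤ 2 ^ length (incList p) ×
    Represents (Rfam p) p ×
    (∀ p' → p' ∈ Rfam p → IsPattern p' × Complete p')
lemma6p11 p p-pat =
  card-Rfam p ,
  Rfam-represents p p-pat ,
  λ p′ p′∈R → let (p′-pat , inc≡∅) = All.lookup (Rfam-patterns p p-pat) p′∈R in
              p′-pat , inc≡∅⇒Complete inc≡∅
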